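{- Let $\mathcal{L}$ be an integer lexicon and $\mathcal{B}_{\mathcal{L}}$ the set of all integer linear constraints over $\mathcal{L}$. Let $P=\langle\Pi,\mathcal{B}_{\mathcal{L}},\gamma\rangle$ be a constraint answer set program over the vocabulary $\sigma=\sigma_r\cup\sigma_i$, and let $X$ be a set of atoms from $\sigma$. Then $X$ is an answer set of $P$ if and only if there is a model $X\cup X_i$, with $X_i\subseteq\sigma_i^{R(\Pi,\sigma_i)}$, of the constraint formula $\langle IComp(\Pi,\sigma_i)\wedge R(\Pi,\sigma_i),\ \mathcal{B}_{\mathcal{L}}\cup\mathcal{B}_{R(\Pi,\sigma_i)},\ \gamma'\rangle$ over $\sigma_r\cup\sigma_i\cup\sigma_i^{R(\Pi,\sigma_i)}$ (regular atoms $\sigma_r$, irregular atoms $\sigma_i\cup\sigma_i^{R(\Pi,\sigma_i)}$), where $\gamma'$ coincides with $\gamma$ on $\sigma_i$ and with $\gamma^{R(\Pi,\sigma_i)}$ on $\sigma_i^{R(\Pi,\sigma_i)}$, and all these constraints are interpreted over the integer lexicon whose variables are those of $\mathcal{L}$ together with $\Sigma^{R(\Pi,\sigma_i)}$ (assumed disjoint).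
   Context: Logic programs. A program $\Pi$ over a vocabulary (set of atoms) $\sigma$ is a set of rules $a\leftarrow b_1,\ldots,b_\ell,\ not\ b_{\ell+1},\ldots,\ not\ b_m,\ not\ not\ b_{m+1},\ldots,\ not\ not\ b_n$ ($a\in\sigma$ or $\bot$, $b_i\in\sigma$), identified with $B\rightarrow a$ where $B=b_1\wedge\cdots\wedge b_\ell\wedge\neg b_{\ell+1}\wedge\cdots\wedge\neg b_m\wedge\neg\neg b_{m+1}\wedge\cdots\wedge\neg\neg b_n$ is the body, $B^+=\{b_1,\dots,b_\ell\}$ its positive part and the rest its negative part. Sets of atoms are identified with assignments making exactly their atoms true. $hd(\Pi)$: heads that are atoms; $Bodies(\Pi,a)$: bodies of rules with head $a$; $At(\Pi)$, $At(F)$: atoms occurring. Reduct $\Pi^X$: delete rules whose negative part $X$ does not satisfy, replace the rest by $a\leftarrow b_1,..,b_\ell$; $X$ is an answer set if it is a minimal set satisfying $\Pi^X$. For $\iota\subseteq\sigma$ with $hd(\Pi)\cap\iota=\emptyset$: $X$ is an input answer set of $\Pi$ relative to $\iota$ if it is an answer set of $\Pi\cup\{a.\mid a\in X\cap\iota\}$; $IComp(\Pi,\iota)$ is the conjunction of the rules of $\Pi$ and the implications $a\rightarrow\bigvee_{B\in Bodies(\Pi,a)}B$ for all $a\in\sigma\setminus\iota$ (empty disjunction $=\bot$). Integer linear constraints. An integer lexicon over a set $V$ of variables has domain $\mathbb{Z}$, binary predicate symbols $<,>,\leq,\geq,=,\neq$ and binary function symbols $+,\times$ with usual meanings. An integer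 linear constraint is $a_1x_1+\cdots+a_nx_n\bowtie k$ with $a_j,k\in\mathbb{Z}$, $x_j\in V$, $\bowtie\in\{<,>,\leq,\geq,=,\neq\}$; a valuation $\nu:V\to\mathbb{Z}$ satisfies it if the relation holds, and satisfies $\neg c$ if $c$ fails ($\neg\neg c$ identified with $c$). A GCSP is a finite set of constraints; a solution is a valuation satisfying all of them. The formula $R(\Pi,\iota)$. For each atom $a$ let $lr_a$ be an integer variable and for atoms $a,b$ let $|lr_a-1\geq lr_b|$ be a fresh propositional atom. $R(\Pi,\iota)$ is the conjunction over all $a\in\sigma\setminus\iota$ of $a\rightarrow\bigvee_{a\leftarrow B\in\Pi,\ B^+\setminus\iota\neq\emptyset}\big(B\wedge\bigwedge_{b\in B^+\setminus\iota}|lr_a-1\geq lr_b|\big)\vee\bigvee_{a\leftarrow B\in\Pi,\ B^+\setminus\iota=\emptyset}B$. $\sigma_i^{R(\Pi,\iota)}$ is the set of atoms $|lr_a-1\geq lr_b|$ occurring in it, $\Sigma^{R(\Pi,\iota)}$ the set of variables occurring in them, $\gamma^{R(\Pi,\iota)}$ maps $|lr_a-1\geq lr_b|$ to the constraint $lr_a-1\geq lr_b$, and $\mathcal{B}_{R(\Pi,\iota)}$ is the set of all integer linear constraints over the integer lexicon with variables $\Sigma^{R(\Pi,\iota)}$. CAS programs and constraint formulas. For disjoint $\sigma_r$ (regular) and $\sigma_i$ (irregular atoms), a constraint answer set program $\langle\Pi,\mathcal{B},\gamma\rangle$ over $\sigma_r\cup\sigma_i$ has $\Pi$ a program with $hd(\Pi)\cap\sigma_i=\emptyset$,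 $\mathcal{B}$ a set of constraints over a lexicon, $\gamma:\sigma_i\to\mathcal{B}$ injective; $X\subseteq At(\Pi)$ is an answer set if it is an input answer set of $\Pi$ relative to $\sigma_i$ and the GCSP $\{\gamma(a)\mid a\in X\cap\sigma_i\}\cup\{\neg\gamma(a)\mid a\in(At(\Pi)\cap\sigma_i)\setminus X\}$ has a solution. A constraint formula $\langle F,\mathcal{B},\gamma\rangle$ has as models the $Y\subseteq At(F)$ satisfying $F$ such that the GCSP $\{\gamma(a)\mid a\in Y\cap\sigma_i\}\cup\{\neg\gamma(a)\mid a\in(At(F)\cap\sigma_i)\setminus Y\}$ has a solution. -}

module Defs where

open import Data.Bool using (Bool; true; false; not; _∧_; _∨_)
open import Data.Bool.ListAction using (all)
open import Data.Nat using (ℕ)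
open import Data.Fin using (Fin; _≟_)
open import Data.Fin.Base using ()
open import Data.List using (List; []; _∷_; map; _++_; filterᵇ; null; foldr; allFin; concatMap)
open import Data.List.Membership.Propositional using (_∈_)
open import Data.List.Relation.Unary.All using (All)
open import Data.Maybe using (Maybe; just; nothing)
open import Data.Product using (_×_; _,_; ∃; Σ)
open import Data.Sum using (_⊎_; inj₁; inj₂)
open import Data.Integer using (ℤ; _<_; _>_; _≤_; _≥_; _+_; _*_; -_; +_)
open import Relation.Binary.PropositionalEquality using (_≡_; _≢_)
open import Relation.Nullary using (¬_; does)

-- a ← b₁..bℓ, not bℓ₊₁..bₘ, not not bₘ₊₁..bₙ ; head nothing = ⊥
record Rule (n : ℕ) : Set where
  constructor rule
  field
    head : Maybe (Fin n)
    pos  : List (Fin n)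
    neg  : List (Fin n)
    nneg : List (Fin n)
open Rule public

Program : ℕ → Set
Program n = List (Rule n)

AtomSet : ℕ → Set
AtomSet n = Fin n → Bool

_⊆_ : ∀ {n} → AtomSet n → AtomSet n → Set
Y ⊆ X = ∀ a → Y a ≡ true → X a ≡ true

negSat : ∀ {n} → AtomSet n → Rule n → Bool
negSat X r = all (λ b → not (X b)) (neg r) ∧ all X (nneg r)

bodySat : ∀ {n} → AtomSet n → Rule n → Bool
bodySat X r = all X (pos r) ∧ negSat X r

headSat : ∀ {n} → AtomSet n → Maybe (Fin n) → Bool
headSat X nothing  = false
headSat X (just a) = X a

ruleSat : ∀ {n} → AtomSet n → Rule n → Bool
ruleSat X r = not (bodySat X r) ∨ headSat X (head r)

progSat : ∀ {n} → AtomSet n → Program n → Set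
progSat X Π = all (ruleSat X) Π ≡ true

reduct : ∀ {n} → Program n → AtomSet n → Program n
reduct Π X = map (λ r → rule (head r) (pos r) [] []) (filterᵇ (negSat X) Π)

IsAnswerSetProg : ∀ {n} → Program n → AtomSet n → Set
IsAnswerSetProg Π X =
  progSat X (reduct Π X) × (∀ Y → Y ⊆ X → progSat Y (reduct Π X) → X ⊆ Y)

facts : ∀ {n} → (ι : Fin n → Bool) → AtomSet n → Program n
facts {n} ι X = map (λ a → rule (just a) [] [] []) (filterᵇ (λ a → X a ∧ ι a) (allFin n))

IsInputAnswerSet : ∀ {n} → Program n → (ι : Fin n → Bool) → AtomSet n → Set
IsInputAnswerSet Π ι X = IsAnswerSetProg (Π ++ facts ι X) X

headAtoms : ∀ {n} → Maybe (Fin n) → List (Fin n)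
headAtoms nothing  = []
headAtoms (just a) = a ∷ []

AtProg : ∀ {n} → Program n → List (Fin n)
AtProg = concatMap (λ r → headAtoms (head r) ++ pos r ++ neg r ++ nneg r)

data Rel : Set where
  lt gt le ge eq ne : Rel

holds : Rel → ℤ → ℤ → Set
holds lt x y = x < y
holds gt x y = x > y
holds le x y = x ≤ y
holds ge x y = x ≥ y
holds eq x y = x ≡ y
holds ne x y = x ≢ y

record LinCon (V : Set) : Set where
  constructor lin
  field
    terms : List (ℤ × V)
    rel   : Rel
    bound : ℤ
open LinCon public

evalTerms : ∀ {V : Set} → (V → ℤ) → List (ℤ × V) → ℤ
evalTerms ν = foldr (λ { (c , x) s → c * ν x + s }) (+ 0)

Sat : ∀ {V : Set} → (V → ℤ) → LinCon V → Set
Sat ν c = holds (rel c) (evalTerms ν (terms c)) (bound c)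

renameCon : ∀ {V W : Set} → (V → W) → LinCon V → LinCon W
renameCon f (lin ts r k) = lin (map (λ { (c , x) → c , f x }) ts) r k

-- Constraint answer set programs ⟨Π, B_L, γ⟩, B_L = LinCon V
-- (all integer linear constraints over the integer lexicon with variables V)

record CASProgram (n : ℕ) (V : Set) : Set where
  field
    prog  : Program n
    irr   : Fin n → Bool                         -- σ_i ; σ_r = the rest
    γ     : (a : Fin n) → irr a ≡ true → LinCon V
    γ-inj : ∀ a b (p : irr a ≡ true) (q : irr b ≡ true) → γ a p ≡ γ b q → a ≡ b
    hd-regular : All (λ r → ∀ a → head r ≡ just a → irr a ≡ false) prog
open CASProgram public

IsAnswerSet : ∀ {n} {V : Set} → CASProgram n V → AtomSet n → Set
IsAnswerSet {n} {V} P X =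
  (∀ a → X a ≡ true → a ∈ AtProg (prog P)) ×
  IsInputAnswerSet (prog P) (irr P) X ×
  ∃ λ (ν : V → ℤ) → ∀ a (p : irr P a ≡ true) → a ∈ AtProg (prog P) →
      (X a ≡ true → Sat ν (γ P a p)) × (X a ≡ false → ¬ Sat ν (γ P a p))

data Form (A : Set) : Set where
  var  : A → Form A
  ⊥f   : Form A
  ¬f_  : Form A → Form A
  _∧f_ : Form A → Form A → Form A
  _∨f_ : Form A → Form A → Form A
  _⇒f_ : Form A → Form A → Form A

⊤f : ∀ {A} → Form A
⊤f = ¬f ⊥f

⋀ : ∀ {A} → List (Form A) → Form A
⋀ []       = ⊤f
⋀ (f ∷ fs) = f ∧f ⋀ fs

⋁ : ∀ {A} → List (Form A) → Form A
⋁ []       = ⊥f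
⋁ (f ∷ fs) = f ∨f ⋁ fs

eval : ∀ {A : Set} → (A → Bool) → Form A → Bool
eval Y (var a)  = Y a
eval Y ⊥f       = false
eval Y (¬f f)   = not (eval Y f)
eval Y (f ∧f g) = eval Y f ∧ eval Y g
eval Y (f ∨f g) = eval Y f ∨ eval Y g
eval Y (f ⇒f g) = not (eval Y f) ∨ eval Y g

atoms : ∀ {A} → Form A → List A
atoms (var a)  = a ∷ []
atoms ⊥f       = []
atoms (¬f f)   = atoms f
atoms (f ∧f g) = atoms f ++ atoms g
atoms (f ∨f g) = atoms f ++ atoms g
atoms (f ⇒f g) = atoms f ++ atoms g

record ConstraintFormula (A Var : Set) : Set where
  field
    form : Form A
    irrF : A → Bool
    γF   : (x : A) → irrF x ≡ true → LinCon Var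
open ConstraintFormula public

IsModel : ∀ {A Var : Set} → ConstraintFormula A Var → (A → Bool) → Set
IsModel {A} {Var} C Y =
  (∀ x → Y x ≡ true → x ∈ atoms (form C)) ×
  eval Y (form C) ≡ true ×
  ∃ λ (ν : Var → ℤ) → ∀ x (p : irrF C x ≡ true) → x ∈ atoms (form C) →
      (Y x ≡ true → Sat ν (γF C x p)) × (Y x ≡ false → ¬ Sat ν (γF C x p))

-- Extended vocabulary σ ∪ σ_i^R : inj₂ (a , b) is the fresh atom |lr_a - 1 ≥ lr_b|

Ext : ℕ → Set
Ext n = Fin n ⊎ (Fin n × Fin n)

lift : ∀ {n} → Fin n → Form (Ext n)
lift a = var (inj₁ a)

bodyF : ∀ {n} → Rule n → Form (Ext n)
bodyF r = ⋀ (map lift (pos r) ++ map (λ b → ¬f lift b) (neg r)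
             ++ map (λ b → ¬f (¬f lift b)) (nneg r))

headF : ∀ {n} → Maybe (Fin n) → Form (Ext n)
headF nothing  = ⊥f
headF (just a) = lift a

ruleF : ∀ {n} → Rule n → Form (Ext n)
ruleF r = bodyF r ⇒f headF (head r)

headIs : ∀ {n} → Fin n → Rule n → Bool
headIs a r with head r
... | nothing = false
... | just b  = does (b ≟ a)

rulesFor : ∀ {n} → Program n → Fin n → Program n
rulesFor Π a = filterᵇ (headIs a) Π

IComp : ∀ {n} → Program n → (Fin n → Bool) → Form (Ext n)
IComp {n} Π ι =
  ⋀ (map ruleF Π) ∧f
  ⋀ (map (λ a → lift a ⇒f ⋁ (map bodyF (rulesFor Π a)))
         (filterᵇ (λ a → not (ι a)) (allFin n)))

posOut : ∀ {n} → (Fin n → Bool) → Rule n → List (Fin n)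
posOut ι r = filterᵇ (λ b → not (ι b)) (pos r)

R : ∀ {n} → Program n → (Fin n → Bool) → Form (Ext n)
R {n} Π ι = ⋀ (map Ra (filterᵇ (λ a → not (ι a)) (allFin n)))
  where
  Ra : Fin n → Form (Ext n)
  Ra a = lift a ⇒f
    (⋁ (map (λ r → bodyF r ∧f ⋀ (map (λ b → var (inj₂ (a , b))) (posOut ι r)))
            (filterᵇ (λ r → not (null (posOut ι r))) (rulesFor Π a)))
     ∨f ⋁ (map bodyF (filterᵇ (λ r → null (posOut ι r)) (rulesFor Π a))))

-- variables of the combined lexicon: V ⊎ {lr_a | a ∈ σ}
-- γ^R : |lr_a - 1 ≥ lr_b|  ↦  1·lr_a + (-1)·lr_b ≥ 1   (i.e. lr_a - 1 ≥ lr_b)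
γR : ∀ {n} {V : Set} → Fin n → Fin n → LinCon (V ⊎ Fin n)
γR a b = lin ((+ 1 , inj₂ a) ∷ (- (+ 1) , inj₂ b) ∷ []) ge (+ 1)

irrExt : ∀ {n} → (Fin n → Bool) → Ext n → Bool
irrExt ι (inj₁ a) = ι a
irrExt ι (inj₂ _) = true

γ′ : ∀ {n} {V : Set} (P : CASProgram n V) →
     (x : Ext n) → irrExt (irr P) x ≡ true → LinCon (V ⊎ Fin n)
γ′ P (inj₁ a) p       = renameCon inj₁ (γ P a p)
γ′ P (inj₂ (a , b)) _ = γR a b

theFormula : ∀ {n} {V : Set} → CASProgram n V → ConstraintFormula (Ext n) (V ⊎ Fin n)
theFormula P = record
  { form = IComp (prog P) (irr P) ∧f R (prog P) (irr P)
  ; irrF = irrExt (irr P)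
  ; γF   = γ′ P }

_∪Ext_ : ∀ {n} → AtomSet n → (Fin n × Fin n → Bool) → Ext n → Bool
(X ∪Ext Xi) (inj₁ a) = X a
(X ∪Ext Xi) (inj₂ p) = Xi p

module Submission where

-- (⇐) A model provides an integer valuation ν.  The rules of IComp make X a model
--   of the reduct, and R gives every regular atom a of X a rule with true body
--   whose external positive body atoms b satisfy ν(lr_b) < ν(lr_a).  Ranking the
--   finitely many values ν(lr_·) into ℕ, induction on the rank shows that X lies
--   inside every model of the reduct, i.e. X is minimal.
-- (⇒) For an answer set X, the iterates of the immediate-consequence operator of
--   the reduct stabilise at a model contained in X, hence equal to X.  Taking lr_a
--   to be the first stage containing a, every a ∈ X has a supporting rule whose
--   positive body lies at strictly lower levels; reading Xi off as lr_b < lr_a makes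
--   IComp ∧ R true, and ν(lr_a) = lr_a solves the level constraints.

open import Defs
open import Data.Nat using (ℕ)
open import Data.Fin using (Fin)
open import Data.Bool using (Bool; true)
open import Data.Product using (_×_; ∃)
open import Data.Sum using (inj₂)
open import Data.List.Membership.Propositional using (_∈_)
open import Relation.Binary.PropositionalEquality using (_≡_)
open import Function.Bundles using (_⇔_)

open import Level using (0ℓ)
open import Function using (_∘_; id)
open import Function.Bundles using (mk⇔; Equivalence)
open import Data.Nat as ℕ using (zero; suc; z≤n; s≤s)
import Data.Nat.Properties as ℕP
open import Data.Nat.Induction using (<-wellFounded)
open import Data.Integer as ℤ using (ℤ; +_; -_; +<+)
import Data.Integer.Properties as ℤP
import Data.Fin as F
import Data.Fin.Properties as FinP
open import Data.Bool using (false; not; _∧_; _∨_; if_then_else_)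
import Data.Bool.Properties as BoolP
open import Data.Bool.ListAction using (all; any)
open import Data.List using (List; []; _∷_; map; _++_; filterᵇ; null; allFin; concatMap; length)
open import Data.List.Relation.Unary.Any using (here; there)
open import Data.List.Relation.Unary.All using (All; []; _∷_)
import Data.List.Relation.Unary.All as All
import Data.List.Relation.Unary.All.Properties as AllP
open import Data.List.Membership.Propositional using (find; lose)
open import Data.List.Membership.Propositional.Properties
  using (∈-map⁺; ∈-map⁻; ∈-++⁺ˡ; ∈-++⁺ʳ; ∈-++⁻; ∈-concatMap⁺; ∈-concatMap⁻; ∈-allFin; ∈-filter⁺; ∈-filter⁻)
import Data.List.Membership.DecPropositional as DecMembership
open import Data.Maybe using (Maybe; just; nothing)
open import Data.Product using (_,_; proj₁; proj₂)
open import Data.Sum using (_⊎_; inj₁)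
import Data.Sum.Properties as SumP
import Data.Product.Properties as ProductP
open import Data.Empty using (⊥; ⊥-elim)
open import Relation.Nullary using (Dec; yes; no; does; ¬_)
open import Relation.Nullary.Decidable using (_×-dec_; dec-true; dec-false; T?)
open import Relation.Binary.PropositionalEquality using (refl; sym; trans; cong; cong₂; subst; subst₂; _≢_; module ≡-Reasoning)
import Relation.Binary.Construct.On as On
import Induction.WellFounded as WF

true≢false : true ≢ false
true≢false ()

∧-trueˡ : ∀ {a b} → a ∧ b ≡ true → a ≡ true
∧-trueˡ {true} _ = refl

∧-trueʳ : ∀ {a b} → a ∧ b ≡ true → b ≡ true
∧-trueʳ {true} h = h

∧-true : ∀ {a b} → a ≡ true → b ≡ true → a ∧ b ≡ true
∧-true refl refl = refl

∨-true : ∀ {a b} → a ∨ b ≡ true → a ≡ true ⊎ b ≡ true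
∨-true {true}  _ = inj₁ refl
∨-true {false} h = inj₂ h

∨-trueˡ : ∀ {a b} → a ≡ true → a ∨ b ≡ true
∨-trueˡ refl = refl

∨-trueʳ : ∀ {a b} → b ≡ true → a ∨ b ≡ true
∨-trueʳ {true}  _ = refl
∨-trueʳ {false} h = h

⇒-true : ∀ {a b} → not a ∨ b ≡ true → a ≡ true → b ≡ true
⇒-true h refl = h

not-true : ∀ {b} → not b ≡ true → b ≡ false
not-true {false} _ = refl

not-false : ∀ {b} → b ≡ false → not b ≡ true
not-false refl = refl

does-true : ∀ {P : Set} (d : Dec P) → does d ≡ true → P
does-true (yes p) _ = p
does-true (no _) ()

module _ {A : Set} where

  all-∈ : ∀ {p : A → Bool} {xs x} → all p xs ≡ true → x ∈ xs → p x ≡ true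
  all-∈ {p} {y ∷ ys} h (here refl) = ∧-trueˡ h
  all-∈ {p} {y ∷ ys} h (there m)   = all-∈ {p} (∧-trueʳ {p y} h) m

  all-intro : ∀ {p : A → Bool} xs → (∀ {x} → x ∈ xs → p x ≡ true) → all p xs ≡ true
  all-intro []       f = refl
  all-intro (x ∷ xs) f = ∧-true (f (here refl)) (all-intro xs (f ∘ there))

  all-mono : ∀ {p q : A → Bool} → (∀ x → p x ≡ true → q x ≡ true) →
             ∀ xs → all p xs ≡ true → all q xs ≡ true
  all-mono p⇒q xs h = all-intro xs λ m → p⇒q _ (all-∈ {xs = xs} h m)

  all-cong : ∀ {p q : A → Bool} xs → (∀ x → p x ≡ q x) → all p xs ≡ all q xs
  all-cong []       e = refl
  all-cong (x ∷ xs) e = cong₂ _∧_ (e x) (all-cong xs e)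

  all-++ : ∀ (p : A → Bool) xs ys → all p (xs ++ ys) ≡ all p xs ∧ all p ys
  all-++ p []       ys = refl
  all-++ p (x ∷ xs) ys = trans (cong (p x ∧_) (all-++ p xs ys)) (sym (BoolP.∧-assoc (p x) _ _))

  any-∈ : ∀ {p : A → Bool} {xs} → any p xs ≡ true → ∃ λ x → x ∈ xs × p x ≡ true
  any-∈ {p} {x ∷ xs} h with ∨-true {p x} h
  ... | inj₁ px = x , here refl , px
  ... | inj₂ h′ = let y , m , py = any-∈ {p} {xs} h′ in y , there m , py

  any-intro : ∀ {p : A → Bool} {xs x} → x ∈ xs → p x ≡ true → any p xs ≡ true
  any-intro {p} {y ∷ ys} (here refl) h = ∨-trueˡ {p y} h
  any-intro {p} {y ∷ ys} (there m)   h = ∨-trueʳ {p y} (any-intro {p} m h)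

  ∈-filterᵇ⁺ : ∀ {p : A → Bool} {xs x} → x ∈ xs → p x ≡ true → x ∈ filterᵇ p xs
  ∈-filterᵇ⁺ {p} m h = ∈-filter⁺ (T? ∘ p) m (Equivalence.from BoolP.T-≡ h)

  ∈-filterᵇ⁻ : ∀ {p : A → Bool} {xs x} → x ∈ filterᵇ p xs → x ∈ xs × p x ≡ true
  ∈-filterᵇ⁻ {p} m = let m′ , t = ∈-filter⁻ (T? ∘ p) m in m′ , Equivalence.to BoolP.T-≡ t

  null-∉ : ∀ {l : List A} {x} → null l ≡ true → x ∈ l → ⊥
  null-∉ {[]} _ ()

  ∈⇒not-null : ∀ {l : List A} {x} → x ∈ l → not (null l) ≡ true
  ∈⇒not-null (here _)  = refl
  ∈⇒not-null (there _) = refl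

module _ {A B : Set} where

  ∈-concatMap-intro : ∀ {f : A → List B} {xs x y} → x ∈ xs → y ∈ f x → y ∈ concatMap f xs
  ∈-concatMap-intro {f} m h = ∈-concatMap⁺ f (lose m h)

  ∈-concatMap-elim : ∀ {f : A → List B} xs {y} → y ∈ concatMap f xs → ∃ λ x → x ∈ xs × y ∈ f x
  ∈-concatMap-elim {f} xs m = find (∈-concatMap⁻ f {xs} m)

  all-map : ∀ (p : B → Bool) (f : A → B) xs → all p (map f xs) ≡ all (p ∘ f) xs
  all-map p f []       = refl
  all-map p f (x ∷ xs) = cong (p (f x) ∧_) (all-map p f xs)

module _ {A : Set} where

  count : (A → Bool) → List A → ℕ
  count f []       = 0
  count f (x ∷ xs) = if f x then suc (count f xs) else count f xs

  count-≤-length : ∀ f xs → count f xs ℕ.≤ length xs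
  count-≤-length f []       = z≤n
  count-≤-length f (x ∷ xs) with f x
  ... | true  = s≤s (count-≤-length f xs)
  ... | false = ℕP.m≤n⇒m≤1+n (count-≤-length f xs)

  count-mono : ∀ {f g : A → Bool} → (∀ x → f x ≡ true → g x ≡ true) →
               ∀ xs → count f xs ℕ.≤ count g xs
  count-mono f⇒g []       = z≤n
  count-mono {f} {g} f⇒g (x ∷ xs) with f x in fx | g x in gx
  ... | true  | true  = s≤s (count-mono f⇒g xs)
  ... | true  | false = ⊥-elim (true≢false (trans (sym (f⇒g x fx)) gx))
  ... | false | true  = ℕP.m≤n⇒m≤1+n (count-mono f⇒g xs)
  ... | false | false = count-mono f⇒g xs

  count-strict : ∀ {f g : A → Bool} → (∀ x → f x ≡ true → g x ≡ true) →
                 ∀ xs {c} → c ∈ xs → g c ≡ true → f c ≡ false → count f xs ℕ.< count g xs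
  count-strict {f} {g} f⇒g (x ∷ xs) (here refl) gc fc rewrite gc | fc = s≤s (count-mono f⇒g xs)
  count-strict {f} {g} f⇒g (x ∷ xs) (there m) gc fc with f x in fx | g x in gx
  ... | true  | true  = s≤s (count-strict f⇒g xs m gc fc)
  ... | true  | false = ⊥-elim (true≢false (trans (sym (f⇒g x fx)) gx))
  ... | false | true  = ℕP.m≤n⇒m≤1+n (count-strict f⇒g xs m gc fc)
  ... | false | false = count-strict f⇒g xs m gc fc

leastIndex : (ℕ → Bool) → ℕ → ℕ
leastIndex f zero    = zero
leastIndex f (suc m) = if f zero then zero else suc (leastIndex (f ∘ suc) m)

leastIndex-≤ : ∀ (f : ℕ → Bool) m → leastIndex f m ℕ.≤ m
leastIndex-≤ f zero    = z≤n
leastIndex-≤ f (suc m) with f zero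
... | true  = z≤n
... | false = s≤s (leastIndex-≤ (f ∘ suc) m)

leastIndex-least : ∀ (f : ℕ → Bool) m k → k ℕ.≤ m → f k ≡ true → leastIndex f m ℕ.≤ k
leastIndex-least f zero    zero _ _ = z≤n
leastIndex-least f (suc m) k k≤m fk with f zero in f0
... | true = z≤n
leastIndex-least f (suc m) zero    _         fk | false = ⊥-elim (true≢false (trans (sym fk) f0))
leastIndex-least f (suc m) (suc k) (s≤s k≤m) fk | false = s≤s (leastIndex-least (f ∘ suc) m k k≤m fk)

leastIndex-holds : ∀ (f : ℕ → Bool) m → f m ≡ true → f (leastIndex f m) ≡ true
leastIndex-holds f zero    fm = fm
leastIndex-holds f (suc m) fm with f zero in f0
... | true  = f0
... | false = leastIndex-holds (f ∘ suc) m fm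

-- Ranks.  An integer valuation of a finite set embeds strictly monotonically
-- into ℕ (count the points with smaller value), and ℕ-valued ranks support
-- well-founded induction.

rankOf : ∀ {n} → (Fin n → ℤ) → Fin n → ℕ
rankOf {n} μ a = count (λ c → does (μ c ℤ.<? μ a)) (allFin n)

rankOf-strict : ∀ {n} (μ : Fin n → ℤ) {a b} → μ b ℤ.< μ a → rankOf μ b ℕ.< rankOf μ a
rankOf-strict {n} μ {a} {b} b<a =
  count-strict (λ c c<b → dec-true (μ c ℤ.<? μ a) (ℤP.<-trans (does-true (μ c ℤ.<? μ b) c<b) b<a))
               (allFin n) (∈-allFin b) (dec-true (μ b ℤ.<? μ a) b<a)
               (dec-false (μ b ℤ.<? μ b) (ℤP.<-irrefl refl))

rank-induction : ∀ {A : Set} (rank : A → ℕ) (P : A → Set) →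
                 (∀ a → (∀ b → rank b ℕ.< rank a → P b) → P a) → ∀ a → P a
rank-induction rank P step =
  WF.All.wfRec (On.wellFounded rank <-wellFounded) 0ℓ P (λ a ih → step a (λ b lt → ih lt))

-- Iterating a monotone operator on sets of atoms from ∅ reaches a fixpoint:
-- until it does, stage k has at least k atoms, and there are only n atoms.

module Iteration {n : ℕ} (step : AtomSet n → AtomSet n)
                 (step-mono : ∀ {S T} → S ⊆ T → step S ⊆ step T) where

  stage : ℕ → AtomSet n
  stage zero    = λ _ → false
  stage (suc k) = step (stage k)

  stage-increasing : ∀ k → stage k ⊆ stage (suc k)
  stage-increasing zero    a ()
  stage-increasing (suc k) = step-mono (stage-increasing k)

  stage-below : ∀ {X} → (∀ S → S ⊆ X → step S ⊆ X) → ∀ k → stage k ⊆ X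
  stage-below closed zero    a ()
  stage-below closed (suc k) = closed (stage k) (stage-below closed k)

  Fixpoint : Set
  Fixpoint = ∃ λ j → step (stage j) ⊆ stage j

  size : ℕ → ℕ
  size k = count (stage k) (allFin n)

  fixpoint-or-large : ∀ k → Fixpoint ⊎ k ℕ.≤ size k
  fixpoint-or-large zero = inj₂ z≤n
  fixpoint-or-large (suc k) with fixpoint-or-large k
  ... | inj₁ fix = inj₁ fix
  ... | inj₂ k≤size with FinP.any? (λ c → (stage (suc k) c BoolP.≟ true) ×-dec (stage k c BoolP.≟ false))
  ...   | yes (c , new , old) =
          inj₂ (ℕP.≤-<-trans k≤size (count-strict (stage-increasing k) (allFin n) (∈-allFin c) new old))
  ...   | no nothing-new = inj₁ (k , stable)
    where
    stable : step (stage k) ⊆ stage k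
    stable a h with stage k a in old
    ... | true  = refl
    ... | false = ⊥-elim (nothing-new (a , h , old))

  -- Stage n + 1 cannot hold n + 1 atoms, so the iteration stops by then.
  fixpoint : Fixpoint
  fixpoint with fixpoint-or-large (suc (length (allFin n)))
  ... | inj₁ fix   = fix
  ... | inj₂ large = ⊥-elim (ℕP.≤⇒≯ (count-≤-length (stage (suc (length (allFin n)))) (allFin n)) large)

module _ {A B : Set} (Y : A → Bool) (f : B → Form A) where

  eval-⋀-map⁻ : ∀ xs → eval Y (⋀ (map f xs)) ≡ true → ∀ {x} → x ∈ xs → eval Y (f x) ≡ true
  eval-⋀-map⁻ (y ∷ ys) h (here refl) = ∧-trueˡ h
  eval-⋀-map⁻ (y ∷ ys) h (there m)   = eval-⋀-map⁻ ys (∧-trueʳ {eval Y (f y)} h) m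

  eval-⋀-map⁺ : ∀ xs → (∀ {x} → x ∈ xs → eval Y (f x) ≡ true) → eval Y (⋀ (map f xs)) ≡ true
  eval-⋀-map⁺ []       h = refl
  eval-⋀-map⁺ (y ∷ ys) h = ∧-true (h (here refl)) (eval-⋀-map⁺ ys (h ∘ there))

  eval-⋁-map⁻ : ∀ xs → eval Y (⋁ (map f xs)) ≡ true → ∃ λ x → x ∈ xs × eval Y (f x) ≡ true
  eval-⋁-map⁻ (y ∷ ys) h with ∨-true {eval Y (f y)} h
  ... | inj₁ fy = y , here refl , fy
  ... | inj₂ h′ = let x , m , fx = eval-⋁-map⁻ ys h′ in x , there m , fx

  eval-⋁-map⁺ : ∀ {xs x} → x ∈ xs → eval Y (f x) ≡ true → eval Y (⋁ (map f xs)) ≡ true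
  eval-⋁-map⁺ {y ∷ ys} (here refl) h = ∨-trueˡ h
  eval-⋁-map⁺ {y ∷ ys} (there m)   h = ∨-trueʳ {eval Y (f y)} (eval-⋁-map⁺ m h)

eval-⋀ : ∀ {A : Set} (Y : A → Bool) fs → eval Y (⋀ fs) ≡ all (eval Y) fs
eval-⋀ Y []       = refl
eval-⋀ Y (f ∷ fs) = cong (eval Y f ∧_) (eval-⋀ Y fs)

AtomsIn : ∀ {A : Set} → (A → Set) → Form A → Set
AtomsIn Q F = ∀ {x} → x ∈ atoms F → Q x

module _ {A : Set} {Q : A → Set} where

  ++-closed : ∀ {xs ys : List A} → (∀ {x} → x ∈ xs → Q x) → (∀ {x} → x ∈ ys → Q x) →
              ∀ {x} → x ∈ xs ++ ys → Q x
  ++-closed {xs} qxs qys m with ∈-++⁻ xs m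
  ... | inj₁ m′ = qxs m′
  ... | inj₂ m′ = qys m′

  atomsIn-⋀ : ∀ {fs} → All (AtomsIn Q) fs → AtomsIn Q (⋀ fs)
  atomsIn-⋀ []         ()
  atomsIn-⋀ (qf ∷ qfs) = ++-closed qf (atomsIn-⋀ qfs)

  atomsIn-⋁ : ∀ {fs} → All (AtomsIn Q) fs → AtomsIn Q (⋁ fs)
  atomsIn-⋁ []         ()
  atomsIn-⋁ (qf ∷ qfs) = ++-closed qf (atomsIn-⋁ qfs)

module _ {A : Set} where

  atoms-⋀⁺ : ∀ {fs f} {x : A} → f ∈ fs → x ∈ atoms f → x ∈ atoms (⋀ fs)
  atoms-⋀⁺ (here refl) m = ∈-++⁺ˡ m
  atoms-⋀⁺ {f′ ∷ _} (there fm) m = ∈-++⁺ʳ (atoms f′) (atoms-⋀⁺ fm m)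

  atoms-⋁⁺ : ∀ {fs f} {x : A} → f ∈ fs → x ∈ atoms f → x ∈ atoms (⋁ fs)
  atoms-⋁⁺ (here refl) m = ∈-++⁺ˡ m
  atoms-⋁⁺ {f′ ∷ _} (there fm) m = ∈-++⁺ʳ (atoms f′) (atoms-⋁⁺ fm m)

module _ {n : ℕ} where

  bodyAtoms : Rule n → List (Fin n)
  bodyAtoms r = pos r ++ neg r ++ nneg r

  eval-body : (X : AtomSet n) (Xi : Fin n × Fin n → Bool) (r : Rule n) →
              eval (X ∪Ext Xi) (bodyF r) ≡ bodySat X r
  eval-body X Xi r = begin
    eval Y (bodyF r)
      ≡⟨ eval-⋀ Y (map lift (pos r) ++ negLits ++ nnegLits) ⟩
    all (eval Y) (map lift (pos r) ++ negLits ++ nnegLits)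
      ≡⟨ all-++ (eval Y) (map lift (pos r)) _ ⟩
    all (eval Y) (map lift (pos r)) ∧ all (eval Y) (negLits ++ nnegLits)
      ≡⟨ cong₂ _∧_ (all-map (eval Y) lift (pos r)) (all-++ (eval Y) negLits _) ⟩
    all X (pos r) ∧ (all (eval Y) negLits ∧ all (eval Y) nnegLits)
      ≡⟨ cong (λ z → all X (pos r) ∧ (z ∧ all (eval Y) nnegLits)) (all-map (eval Y) (λ b → ¬f lift b) (neg r)) ⟩
    all X (pos r) ∧ (all (λ b → not (X b)) (neg r) ∧ all (eval Y) nnegLits)
      ≡⟨ cong (λ z → all X (pos r) ∧ (all (λ b → not (X b)) (neg r) ∧ z)) nneg-cancel ⟩
    bodySat X r ∎
    where
    open ≡-Reasoning
    Y = X ∪Ext Xi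
    negLits nnegLits : List (Form (Ext n))
    negLits  = map (λ b → ¬f lift b) (neg r)
    nnegLits = map (λ b → ¬f (¬f lift b)) (nneg r)
    -- double negation is classical on truth values
    nneg-cancel : all (eval Y) nnegLits ≡ all X (nneg r)
    nneg-cancel = trans (all-map (eval Y) (λ b → ¬f (¬f lift b)) (nneg r))
                        (all-cong (nneg r) (λ b → BoolP.not-involutive (X b)))

  eval-rule : (X : AtomSet n) (Xi : Fin n × Fin n → Bool) (r : Rule n) →
              eval (X ∪Ext Xi) (ruleF r) ≡ ruleSat X r
  eval-rule X Xi r = cong₂ (λ u v → not u ∨ v) (eval-body X Xi r) (eval-head (head r))
    where
    eval-head : (h : Maybe (Fin n)) → eval (X ∪Ext Xi) (headF h) ≡ headSat X h
    eval-head nothing  = refl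
    eval-head (just a) = refl

  Original : (Fin n → Set) → Ext n → Set
  Original q x = ∃ λ b → x ≡ inj₁ b × q b

  lift-atoms : ∀ {q : Fin n → Set} {b} → q b → AtomsIn (Original q) (lift b)
  lift-atoms qb (here refl) = _ , refl , qb

  body-atoms : ∀ {q : Fin n → Set} r → (∀ {b} → b ∈ bodyAtoms r → q b) → AtomsIn (Original q) (bodyF r)
  body-atoms {q} r qr = atomsIn-⋀ (AllP.++⁺ posLits (AllP.++⁺ negLits nnegLits))
    where
    posLits : All (AtomsIn (Original q)) (map lift (pos r))
    posLits = AllP.map⁺ (All.tabulate (lift-atoms ∘ qr ∘ ∈-++⁺ˡ))
    negLits : All (AtomsIn (Original q)) (map (λ b → ¬f lift b) (neg r))
    negLits = AllP.map⁺ (All.tabulate (lift-atoms ∘ qr ∘ ∈-++⁺ʳ (pos r) ∘ ∈-++⁺ˡ))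
    nnegLits : All (AtomsIn (Original q)) (map (λ b → ¬f (¬f lift b)) (nneg r))
    nnegLits = AllP.map⁺ (All.tabulate (lift-atoms ∘ qr ∘ ∈-++⁺ʳ (pos r) ∘ ∈-++⁺ʳ (neg r)))

  head-atoms : ∀ {q : Fin n → Set} h → (∀ {b} → b ∈ headAtoms h → q b) → AtomsIn (Original q) (headF h)
  head-atoms nothing  qh ()
  head-atoms (just a) qh = lift-atoms (qh (here refl))

  rule-atoms : ∀ {q : Fin n → Set} r → (∀ {b} → b ∈ headAtoms (head r) ++ bodyAtoms r → q b) →
               AtomsIn (Original q) (ruleF r)
  rule-atoms r qr = ++-closed (body-atoms r (qr ∘ ∈-++⁺ʳ (headAtoms (head r))))
                              (head-atoms (head r) (qr ∘ ∈-++⁺ˡ))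

  body-atoms⁺ : ∀ r {b} → b ∈ bodyAtoms r → inj₁ b ∈ atoms (bodyF r)
  body-atoms⁺ r m with ∈-++⁻ (pos r) m
  ... | inj₁ m⁺ = atoms-⋀⁺ (∈-++⁺ˡ (∈-map⁺ lift m⁺)) (here refl)
  ... | inj₂ m′ with ∈-++⁻ (neg r) m′
  ...   | inj₁ m⁻  = atoms-⋀⁺ (∈-++⁺ʳ (map lift (pos r)) (∈-++⁺ˡ (∈-map⁺ (λ b → ¬f lift b) m⁻))) (here refl)
  ...   | inj₂ m⁻⁻ = atoms-⋀⁺ (∈-++⁺ʳ (map lift (pos r)) (∈-++⁺ʳ (map (λ b → ¬f lift b) (neg r))
                                (∈-map⁺ (λ b → ¬f (¬f lift b)) m⁻⁻))) (here refl)

1≤x-y⇒y<x : ∀ x y → + 1 ℤ.≤ x ℤ.- y → y ℤ.< x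
1≤x-y⇒y<x x y h = subst₂ ℤ._<_ (ℤP.+-identityˡ y) x-y+y≡x (ℤP.+-monoˡ-< y (ℤP.<-≤-trans (+<+ (s≤s z≤n)) h))
  where
  x-y+y≡x : (x ℤ.- y) ℤ.+ y ≡ x
  x-y+y≡x = trans (ℤP.+-assoc x (- y) y) (trans (cong (λ z → x ℤ.+ z) (ℤP.+-inverseˡ y)) (ℤP.+-identityʳ x))

y<x⇒1≤x-y : ∀ x y → y ℤ.< x → + 1 ℤ.≤ x ℤ.- y
y<x⇒1≤x-y x y h = ℤP.i<j⇒suc[i]≤j (subst (ℤ._< x ℤ.- y) (ℤP.+-inverseʳ y) (ℤP.+-monoˡ-< (- y) h))

module _ {n : ℕ} {V : Set} (ν : V ⊎ Fin n → ℤ) (a b : Fin n) where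

  γR-term : evalTerms ν (terms (γR {V = V} a b)) ≡ ν (inj₂ a) ℤ.- ν (inj₂ b)
  γR-term = cong₂ ℤ._+_ (ℤP.*-identityˡ (ν (inj₂ a)))
    (trans (ℤP.+-identityʳ _) (trans (sym (ℤP.neg-distribˡ-* (+ 1) (ν (inj₂ b))))
                                     (cong -_ (ℤP.*-identityˡ (ν (inj₂ b))))))

  γR-sound : Sat ν (γR a b) → ν (inj₂ b) ℤ.< ν (inj₂ a)
  γR-sound h = 1≤x-y⇒y<x _ _ (subst (+ 1 ℤ.≤_) γR-term h)

  γR-complete : ν (inj₂ b) ℤ.< ν (inj₂ a) → Sat ν (γR a b)
  γR-complete h = subst (+ 1 ℤ.≤_) (sym γR-term) (y<x⇒1≤x-y _ _ h)

sat-rename : ∀ {n : ℕ} {V : Set} (ν : V ⊎ Fin n → ℤ) (c : LinCon V) →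
             Sat ν (renameCon inj₁ c) ≡ Sat (ν ∘ inj₁) c
sat-rename ν c = cong (λ e → holds (rel c) e (bound c)) (eval-renamed (terms c))
  where
  eval-renamed : ∀ ts → evalTerms ν (map (λ { (k , x) → k , inj₁ x }) ts) ≡ evalTerms (ν ∘ inj₁) ts
  eval-renamed []             = refl
  eval-renamed ((k , x) ∷ ts) = cong (λ z → k ℤ.* ν (inj₁ x) ℤ.+ z) (eval-renamed ts)

module _ {n : ℕ} where

  ruleSat-intro : ∀ {X : AtomSet n} r → (all X (pos r) ≡ true → negSat X r ≡ true → headSat X (head r) ≡ true) →
                  ruleSat X r ≡ true
  ruleSat-intro {X} r fire with all X (pos r) in pos-ok | negSat X r in neg-ok
  ... | true  | true  = fire refl refl
  ... | true  | false = refl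
  ... | false | _     = refl

  reduct-sat⁻ : ∀ {Π : Program n} {Y X : AtomSet n} {r} → progSat Y (reduct Π X) → r ∈ Π →
                negSat X r ≡ true → all Y (pos r) ≡ true → headSat Y (head r) ≡ true
  reduct-sat⁻ {Y = Y} {X} hY rm neg-ok pos-ok =
    ⇒-true (all-∈ {p = ruleSat Y} hY (∈-map⁺ (λ r → rule (head r) (pos r) [] [])
                                               (∈-filterᵇ⁺ {p = negSat X} rm neg-ok)))
           (∧-true pos-ok refl)

  reduct-sat⁺ : ∀ {Π : Program n} {Y X : AtomSet n} →
                (∀ {r} → r ∈ Π → negSat X r ≡ true → all Y (pos r) ≡ true → headSat Y (head r) ≡ true) →
                progSat Y (reduct Π X)
  reduct-sat⁺ {Π} {Y} {X} fires = all-intro _ λ m →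
    let r , rm , r′≡ = ∈-map⁻ (λ r → rule (head r) (pos r) [] []) m
        rm′ , neg-ok = ∈-filterᵇ⁻ {p = negSat X} {xs = Π} rm
    in subst (λ r′ → ruleSat Y r′ ≡ true) (sym r′≡)
             (ruleSat-intro (rule (head r) (pos r) [] []) λ pos-ok _ → fires rm′ neg-ok pos-ok)

  facts⁻ : ∀ {ι X : AtomSet n} {r} → r ∈ facts ι X →
           ∃ λ a → (X a ∧ ι a) ≡ true × r ≡ rule (just a) [] [] []
  facts⁻ {ι} {X} m with ∈-map⁻ (λ a → rule (just a) [] [] []) m
  ... | a , am , r≡ = a , proj₂ (∈-filterᵇ⁻ {p = λ a → X a ∧ ι a} {xs = allFin n} am) , r≡

  facts⁺ : ∀ {ι X : AtomSet n} {a} → (X a ∧ ι a) ≡ true → rule (just a) [] [] [] ∈ facts ι X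
  facts⁺ {ι} {X} {a} h = ∈-map⁺ (λ a → rule (just a) [] [] []) (∈-filterᵇ⁺ {p = λ a → X a ∧ ι a} (∈-allFin a) h)

module Encoding {n : ℕ} {V : Set} (P : CASProgram n V) where

  Π : Program n
  Π = prog P

  ι : Fin n → Bool
  ι = irr P

  regular : List (Fin n)
  regular = filterᵇ (λ a → not (ι a)) (allFin n)

  levelBody : Fin n → Rule n → Form (Ext n)
  levelBody a r = bodyF r ∧f ⋀ (map (λ b → var (inj₂ (a , b))) (posOut ι r))

  rankedRules unrankedRules : Fin n → Program n
  rankedRules a   = filterᵇ (λ r → not (null (posOut ι r))) (rulesFor Π a)
  unrankedRules a = filterᵇ (λ r → null (posOut ι r)) (rulesFor Π a)

  levelCondition : Fin n → Form (Ext n)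
  levelCondition a = lift a ⇒f (⋁ (map (levelBody a) (rankedRules a)) ∨f ⋁ (map bodyF (unrankedRules a)))

  completion : Fin n → Form (Ext n)
  completion a = lift a ⇒f ⋁ (map bodyF (rulesFor Π a))

  Φ : Form (Ext n)
  Φ = form (theFormula P)

  inputReduct : AtomSet n → Program n
  inputReduct X = reduct (Π ++ facts ι X) X

  ∈-regular⁺ : ∀ {a} → ι a ≡ false → a ∈ regular
  ∈-regular⁺ {a} e = ∈-filterᵇ⁺ {p = λ a → not (ι a)} (∈-allFin a) (not-false e)

  ∈-regular⁻ : ∀ {a} → a ∈ regular → ι a ≡ false
  ∈-regular⁻ m = not-true (proj₂ (∈-filterᵇ⁻ {p = λ a → not (ι a)} {xs = allFin n} m))

  ∈-rulesFor⁻ : ∀ {a r} → r ∈ rulesFor Π a → r ∈ Π × head r ≡ just a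
  ∈-rulesFor⁻ {a} {r} m = let rm , is-a = ∈-filterᵇ⁻ {p = headIs a} {xs = Π} m in rm , head-is r is-a
    where
    head-is : ∀ r → headIs a r ≡ true → head r ≡ just a
    head-is r h with head r
    head-is r () | nothing
    ... | just b with b F.≟ a
    ...   | yes refl = refl
    head-is r () | just b | no _

  ∈-rulesFor⁺ : ∀ {a r} → r ∈ Π → head r ≡ just a → r ∈ rulesFor Π a
  ∈-rulesFor⁺ {a} {r} rm hd = ∈-filterᵇ⁺ {p = headIs a} rm (head-is hd)
    where
    head-is : head r ≡ just a → headIs a r ≡ true
    head-is hd rewrite hd = dec-true (a F.≟ a) refl

  head-regular : ∀ {a r} → r ∈ Π → head r ≡ just a → ι a ≡ false
  head-regular rm hd = All.lookup (hd-regular P) rm _ hd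

  ∈-AtProg : ∀ {b r} → r ∈ Π → b ∈ headAtoms (head r) ++ bodyAtoms r → b ∈ AtProg Π
  ∈-AtProg rm m = ∈-concatMap-intro rm m

  body∈AtProg : ∀ {a b r} → r ∈ rulesFor Π a → b ∈ bodyAtoms r → b ∈ AtProg Π
  body∈AtProg {r = r} rm m = ∈-AtProg (proj₁ (∈-rulesFor⁻ rm)) (∈-++⁺ʳ (headAtoms (head r)) m)

  Known : Fin n → Set
  Known a = ι a ≡ false ⊎ a ∈ AtProg Π

  LevelAtom : Ext n → Set
  LevelAtom x = ∃ λ p → x ≡ inj₂ p

  IComp-atoms : AtomsIn (Original Known) (IComp Π ι)
  IComp-atoms = ++-closed (atomsIn-⋀ rules-known) (atomsIn-⋀ completions-known)
    where
    rules-known : All (AtomsIn (Original Known)) (map ruleF Π)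
    rules-known = AllP.map⁺ (All.tabulate λ {r} rm → rule-atoms r (inj₂ ∘ ∈-AtProg rm))
    completion-known : ∀ {a} → a ∈ regular → AtomsIn (Original Known) (completion a)
    completion-known {a} am = ++-closed {xs = atoms (lift a)} (lift-atoms (inj₁ (∈-regular⁻ am)))
      (atomsIn-⋁ (AllP.map⁺ (All.tabulate λ {r} rm → body-atoms r (inj₂ ∘ body∈AtProg rm))))
    completions-known : All (AtomsIn (Original Known)) (map completion regular)
    completions-known = AllP.map⁺ (All.tabulate completion-known)

  R-atoms : AtomsIn (λ x → Original Known x ⊎ LevelAtom x) (R Π ι)
  R-atoms = atomsIn-⋀ conditions
    where
    Q : Ext n → Set
    Q x = Original Known x ⊎ LevelAtom x
    body-known : ∀ {a r} → r ∈ rulesFor Π a → AtomsIn Q (bodyF r)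
    body-known {r = r} rm m = inj₁ (body-atoms r (inj₂ ∘ body∈AtProg rm) m)
    levels : ∀ a bs → AtomsIn Q (⋀ (map (λ b → var (inj₂ (a , b))) bs))
    levels a bs = atomsIn-⋀ {Q = Q} (AllP.map⁺ {f = λ b → var (inj₂ (a , b))} (All.tabulate level))
      where
      level : ∀ {b} → b ∈ bs → AtomsIn Q (var (inj₂ (a , b)))
      level _ (here refl) = inj₂ (_ , refl)
    ranked : ∀ a → All (AtomsIn Q) (map (levelBody a) (rankedRules a))
    ranked a = AllP.map⁺ (All.tabulate λ {r} rm →
      ++-closed (body-known (proj₁ (∈-filterᵇ⁻ rm))) (levels a (posOut ι r)))
    unranked : ∀ a → All (AtomsIn Q) (map bodyF (unrankedRules a))
    unranked a = AllP.map⁺ (All.tabulate λ rm → body-known (proj₁ (∈-filterᵇ⁻ rm)))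
    condition-atoms : ∀ {a} → a ∈ regular → AtomsIn Q (levelCondition a)
    condition-atoms {a} am = ++-closed {xs = atoms (lift a)} (inj₁ ∘ lift-atoms (inj₁ (∈-regular⁻ am)))
                                       (++-closed (atomsIn-⋁ (ranked a)) (atomsIn-⋁ (unranked a)))
    conditions : All (AtomsIn Q) (map levelCondition regular)
    conditions = AllP.map⁺ (All.tabulate condition-atoms)

  formula-irregular : ∀ {a} → inj₁ a ∈ atoms Φ → ι a ≡ true → a ∈ AtProg Π
  formula-irregular {a} m ia with ∈-++⁻ (atoms (IComp Π ι)) m
  ... | inj₁ m′ = known (IComp-atoms m′)
    where
    known : Original Known (inj₁ a) → a ∈ AtProg Π
    known (_ , refl , inj₁ reg) = ⊥-elim (true≢false (trans (sym ia) reg))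
    known (_ , refl , inj₂ atp) = atp
  ... | inj₂ m′ = known (R-atoms m′)
    where
    known : Original Known (inj₁ a) ⊎ LevelAtom (inj₁ a) → a ∈ AtProg Π
    known (inj₁ (_ , refl , inj₁ reg)) = ⊥-elim (true≢false (trans (sym ia) reg))
    known (inj₁ (_ , refl , inj₂ atp)) = atp
    known (inj₂ (_ , ()))

  formula-level : ∀ {p} → inj₂ p ∈ atoms Φ → inj₂ p ∈ atoms (R Π ι)
  formula-level m with ∈-++⁻ (atoms (IComp Π ι)) m
  ... | inj₁ m′ with IComp-atoms m′
  ...   | _ , () , _
  formula-level m | inj₂ m′ = m′

  AtProg⇒formula : ∀ {a} → a ∈ AtProg Π → ι a ≡ true → inj₁ a ∈ atoms Φ
  AtProg⇒formula {a} m ia with ∈-concatMap-elim {f = λ r → headAtoms (head r) ++ bodyAtoms r} Π m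
  ... | r , rm , am with ∈-++⁻ (headAtoms (head r)) am
  ...   | inj₂ in-body = ∈-++⁺ˡ (∈-++⁺ˡ (atoms-⋀⁺ (∈-map⁺ ruleF rm) (∈-++⁺ˡ (body-atoms⁺ r in-body))))
  ...   | inj₁ in-head with head r in hd
  ...     | just b with in-head
  ...       | here refl = ⊥-elim (true≢false (trans (sym ia) (head-regular rm hd)))

  regular⇒formula : ∀ {a} → ι a ≡ false → inj₁ a ∈ atoms Φ
  regular⇒formula {a} reg =
    ∈-++⁺ˡ (∈-++⁺ʳ (atoms (⋀ (map ruleF Π))) (atoms-⋀⁺ (∈-map⁺ completion (∈-regular⁺ reg)) (here refl)))

  level∈R : ∀ {a b r} → ι a ≡ false → r ∈ rulesFor Π a → b ∈ posOut ι r → inj₂ (a , b) ∈ atoms (R Π ι)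
  level∈R {a} {b} {r} reg rm bm = atoms-⋀⁺ (∈-map⁺ levelCondition (∈-regular⁺ reg))
    (there (∈-++⁺ˡ (atoms-⋁⁺ (∈-map⁺ (levelBody a) ranked)
      (∈-++⁺ʳ (atoms (bodyF r)) (atoms-⋀⁺ (∈-map⁺ (λ b → var (inj₂ (a , b))) bm) (here refl))))))
    where
    ranked : r ∈ rankedRules a
    ranked = ∈-filterᵇ⁺ {p = λ r → not (null (posOut ι r))} rm (∈⇒not-null bm)

-- (⇐) A model X ∪ Xi of the formula restricts to an answer set X of P.

module ModelToAnswerSet {n : ℕ} {V : Set} (P : CASProgram n V) (X : AtomSet n)
                        (Xi : Fin n × Fin n → Bool) (model : IsModel (theFormula P) (X ∪Ext Xi)) where
  open Encoding P

  Y : Ext n → Bool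
  Y = X ∪Ext Xi

  ν′ : V ⊎ Fin n → ℤ
  ν′ = proj₁ (proj₂ (proj₂ model))

  ν′-solves : ∀ x (p : irrExt ι x ≡ true) → x ∈ atoms Φ →
              (Y x ≡ true → Sat ν′ (γ′ P x p)) × (Y x ≡ false → ¬ Sat ν′ (γ′ P x p))
  ν′-solves = proj₂ (proj₂ (proj₂ model))

  IComp-true : eval Y (IComp Π ι) ≡ true
  IComp-true = ∧-trueˡ (proj₁ (proj₂ model))

  R-true : eval Y (R Π ι) ≡ true
  R-true = ∧-trueʳ {eval Y (IComp Π ι)} (proj₁ (proj₂ model))

  level : Fin n → ℤ
  level a = ν′ (inj₂ a)

  rule-holds : ∀ {r} → r ∈ Π → ruleSat X r ≡ true
  rule-holds {r} rm = trans (sym (eval-rule X Xi r)) (eval-⋀-map⁻ Y ruleF Π (∧-trueˡ IComp-true) rm)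

  level-below : ∀ {a b r} → ι a ≡ false → r ∈ rulesFor Π a → b ∈ posOut ι r →
                Xi (a , b) ≡ true → level b ℤ.< level a
  level-below {a} {b} reg rm bm xi =
    γR-sound ν′ a b (proj₁ (ν′-solves (inj₂ (a , b)) refl (∈-++⁺ʳ (atoms (IComp Π ι)) (level∈R reg rm bm))) xi)

  record Support (a : Fin n) : Set where
    field
      supporting     : Rule n
      supporting∈    : supporting ∈ rulesFor Π a
      body-holds     : bodySat X supporting ≡ true
      positive-below : ∀ {b} → b ∈ posOut ι supporting → level b ℤ.< level a

  support : ∀ a → ι a ≡ false → X a ≡ true → Support a
  support a reg xa with ∨-true (⇒-true {X a} (eval-⋀-map⁻ Y levelCondition regular R-true (∈-regular⁺ reg)) xa)
  ... | inj₁ ranked-true =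
    let r , rm , r-true = eval-⋁-map⁻ Y (levelBody a) (rankedRules a) ranked-true
        r∈ = proj₁ (∈-filterᵇ⁻ rm)
        levels-true = eval-⋀-map⁻ Y (λ b → var (inj₂ (a , b))) (posOut ι r) (∧-trueʳ {eval Y (bodyF r)} r-true)
    in record { supporting = r ; supporting∈ = r∈
              ; body-holds = trans (sym (eval-body X Xi r)) (∧-trueˡ r-true)
              ; positive-below = λ bm → level-below reg r∈ bm (levels-true bm) }
  ... | inj₂ unranked-true =
    let r , rm , r-true = eval-⋁-map⁻ Y bodyF (unrankedRules a) unranked-true
        r∈ , no-external = ∈-filterᵇ⁻ {p = λ r → null (posOut ι r)} rm
    in record { supporting = r ; supporting∈ = r∈
              ; body-holds = trans (sym (eval-body X Xi r)) r-true
              ; positive-below = λ bm → ⊥-elim (null-∉ no-external bm) }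

  -- irregular atoms of X occur in the formula, hence in Π; regular ones head their support
  X⊆AtProg : ∀ a → X a ≡ true → a ∈ AtProg Π
  X⊆AtProg a xa with ι a in ia
  ... | true  = formula-irregular (proj₁ model (inj₁ a) xa) ia
  ... | false = ∈-AtProg rm (subst (λ h → a ∈ headAtoms h ++ bodyAtoms supporting) (sym hd) (here refl))
    where
    open Support (support a ia xa)
    rm = proj₁ (∈-rulesFor⁻ supporting∈)
    hd = proj₂ (∈-rulesFor⁻ supporting∈)

  X-models-reduct : progSat X (inputReduct X)
  X-models-reduct = reduct-sat⁺ λ {r} rm neg-ok pos-ok → fires (∈-++⁻ Π rm) neg-ok pos-ok
    where
    fires : ∀ {r} → r ∈ Π ⊎ r ∈ facts ι X → negSat X r ≡ true → all X (pos r) ≡ true → headSat X (head r) ≡ true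
    fires (inj₁ rm) neg-ok pos-ok = ⇒-true (rule-holds rm) (∧-true pos-ok neg-ok)
    fires (inj₂ fm) _ _ with facts⁻ {ι = ι} {X = X} fm
    ... | a , xa∧ia , refl = ∧-trueˡ xa∧ia

  -- Minimality, by induction on the rank of the model's levels: a regular atom of X
  -- is derived in Z from its support, whose external positive body has smaller rank.
  X-minimal : ∀ Z → progSat Z (inputReduct X) → X ⊆ Z
  X-minimal Z Z-model = rank-induction (rankOf level) (λ a → X a ≡ true → Z a ≡ true) derive
    where
    fact-in-Z : ∀ {b} → ι b ≡ true → X b ≡ true → Z b ≡ true
    fact-in-Z {b} ib xb = reduct-sat⁻ Z-model (∈-++⁺ʳ Π (facts⁺ {ι = ι} {X = X} (∧-true xb ib))) refl refl

    derive : ∀ a → (∀ b → rankOf level b ℕ.< rankOf level a → X b ≡ true → Z b ≡ true) → X a ≡ true → Z a ≡ true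
    derive a ih xa with ι a in ia
    ... | true  = fact-in-Z ia xa
    ... | false = subst (λ h → headSat Z h ≡ true) hd
                        (reduct-sat⁻ Z-model (∈-++⁺ˡ rm) (∧-trueʳ {all X (pos r)} body-holds) body-in-Z)
      where
      open Support (support a ia xa)
      r = supporting
      rm = proj₁ (∈-rulesFor⁻ supporting∈)
      hd = proj₂ (∈-rulesFor⁻ supporting∈)
      positive-in-Z : ∀ {b} → b ∈ pos r → Z b ≡ true
      positive-in-Z {b} bm with ι b in ib
      ... | true  = fact-in-Z ib (all-∈ (∧-trueˡ body-holds) bm)
      ... | false = ih b (rankOf-strict level (positive-below (∈-filterᵇ⁺ {p = λ b → not (ι b)} bm (not-false ib))))
                         (all-∈ (∧-trueˡ body-holds) bm)
      body-in-Z : all Z (pos r) ≡ true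
      body-in-Z = all-intro (pos r) positive-in-Z

  -- the V-part of ν′ solves the constraints of P, which IsModel imposes via renaming
  answer-set : IsAnswerSet P X
  answer-set = X⊆AtProg , (X-models-reduct , λ Z _ → X-minimal Z) , ν′ ∘ inj₁ , solves
    where
    solves : ∀ a (p : ι a ≡ true) → a ∈ AtProg Π →
             (X a ≡ true → Sat (ν′ ∘ inj₁) (γ P a p)) × (X a ≡ false → ¬ Sat (ν′ ∘ inj₁) (γ P a p))
    solves a p am =
      let sat , unsat = ν′-solves (inj₁ a) p (AtProg⇒formula am p)
          renamed = sat-rename ν′ (γ P a p)
      in (λ xa → subst id renamed (sat xa)) , (λ xa s → unsat xa (subst id (sym renamed) s))

-- (⇒) An answer set X extends to a model of the formula: lr_a is the first stage
-- of the least-model iteration of Π^X at which a is derived.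

module AnswerSetToModel {n : ℕ} {V : Set} (P : CASProgram n V) (X : AtomSet n) (answer : IsAnswerSet P X) where
  open Encoding P

  X⊆AtProg : ∀ a → X a ≡ true → a ∈ AtProg Π
  X⊆AtProg = proj₁ answer

  X-minimal : ∀ Z → Z ⊆ X → progSat Z (inputReduct X) → X ⊆ Z
  X-minimal = proj₂ (proj₁ (proj₂ answer))

  ν : V → ℤ
  ν = proj₁ (proj₂ (proj₂ answer))

  fires-in-X : ∀ {r} → r ∈ Π → negSat X r ≡ true → all X (pos r) ≡ true → headSat X (head r) ≡ true
  fires-in-X rm = reduct-sat⁻ (proj₁ (proj₁ (proj₂ answer))) (∈-++⁺ˡ rm)

  consequences : AtomSet n → AtomSet n
  consequences S a = (X a ∧ ι a) ∨ any (λ r → negSat X r ∧ all S (pos r)) (rulesFor Π a)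

  consequences-mono : ∀ {S T} → S ⊆ T → consequences S ⊆ consequences T
  consequences-mono {S} {T} S⊆T a h with ∨-true {X a ∧ ι a} h
  ... | inj₁ fact = ∨-trueˡ fact
  ... | inj₂ fired with any-∈ {p = λ r → negSat X r ∧ all S (pos r)} {xs = rulesFor Π a} fired
  ...   | r , rm , r-fires = ∨-trueʳ {X a ∧ ι a} (any-intro {p = λ r → negSat X r ∧ all T (pos r)} rm
            (∧-true (∧-trueˡ r-fires) (all-mono S⊆T (pos r) (∧-trueʳ {negSat X r} r-fires))))

  open Iteration consequences consequences-mono

  consequences-below-X : ∀ S → S ⊆ X → consequences S ⊆ X
  consequences-below-X S S⊆X a h with ∨-true {X a ∧ ι a} h
  ... | inj₁ fact = ∧-trueˡ fact
  ... | inj₂ fired with any-∈ {p = λ r → negSat X r ∧ all S (pos r)} {xs = rulesFor Π a} fired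
  ...   | r , rm , r-fires = subst (λ h → headSat X h ≡ true) (proj₂ (∈-rulesFor⁻ rm))
            (fires-in-X (proj₁ (∈-rulesFor⁻ rm)) (∧-trueˡ r-fires) (all-mono S⊆X (pos r) (∧-trueʳ {negSat X r} r-fires)))

  j : ℕ
  j = proj₁ fixpoint

  -- The stable stage is a model of Π^X below X, hence equal to X by minimality.
  stable-models-reduct : progSat (stage j) (inputReduct X)
  stable-models-reduct = reduct-sat⁺ λ {r} rm neg-ok pos-ok → fires (∈-++⁻ Π rm) neg-ok pos-ok
    where
    fires : ∀ {r} → r ∈ Π ⊎ r ∈ facts ι X → negSat X r ≡ true → all (stage j) (pos r) ≡ true →
            headSat (stage j) (head r) ≡ true
    fires {r} (inj₁ rm) neg-ok pos-ok with head r in hd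
    ... | nothing = ⊥-elim (true≢false (sym (subst (λ h → headSat X h ≡ true) hd
                      (fires-in-X rm neg-ok (all-mono (stage-below consequences-below-X j) (pos r) pos-ok)))))
    ... | just a  = proj₂ fixpoint a (∨-trueʳ {X a ∧ ι a}
                      (any-intro {p = λ r → negSat X r ∧ all (stage j) (pos r)} (∈-rulesFor⁺ rm hd) (∧-true neg-ok pos-ok)))
    fires (inj₂ fm) _ _ with facts⁻ {ι = ι} {X = X} fm
    ... | a , fact , refl = proj₂ fixpoint a (∨-trueˡ fact)

  X⊆stable : X ⊆ stage j
  X⊆stable = X-minimal (stage j) (stage-below consequences-below-X j) stable-models-reduct

  lr : Fin n → ℕ
  lr a = leastIndex (λ k → stage k a) j

  record Derivation (a : Fin n) (k : ℕ) : Set where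
    field
      deriving   : Rule n
      deriving∈  : deriving ∈ rulesFor Π a
      body-holds : bodySat X deriving ≡ true
      earlier    : ∀ {b} → b ∈ pos deriving → lr b ℕ.< k

  derivation : ∀ a k → k ℕ.≤ j → stage k a ≡ true → ι a ≡ false → Derivation a k
  derivation a zero    _   ()  _
  derivation a (suc k) k<j h reg with ∨-true {X a ∧ ι a} h
  ... | inj₁ fact = ⊥-elim (true≢false (trans (sym (∧-trueʳ {X a} fact)) reg))
  ... | inj₂ fired with any-∈ {p = λ r → negSat X r ∧ all (stage k) (pos r)} {xs = rulesFor Π a} fired
  ...   | r , rm , r-fires = record
    { deriving = r ; deriving∈ = rm
    ; body-holds = ∧-true (all-mono (stage-below consequences-below-X k) (pos r) pos-at-k) (∧-trueˡ r-fires)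
    ; earlier = λ {b} bm → s≤s (leastIndex-least (λ k → stage k b) j k (ℕP.<⇒≤ k<j) (all-∈ pos-at-k bm)) }
    where
    pos-at-k : all (stage k) (pos r) ≡ true
    pos-at-k = ∧-trueʳ {negSat X r} r-fires

  support : ∀ a → ι a ≡ false → X a ≡ true → Derivation a (lr a)
  support a reg xa = derivation a (lr a) (leastIndex-≤ (λ k → stage k a) j)
                                (leastIndex-holds (λ k → stage k a) j (X⊆stable a xa)) reg

  _∈R?_ : (x : Ext n) (l : List (Ext n)) → Dec (x ∈ l)
  _∈R?_ = DecMembership._∈?_ (SumP.≡-dec F._≟_ (ProductP.≡-dec F._≟_ F._≟_))

  Xi : Fin n × Fin n → Bool
  Xi (a , b) = does (lr b ℕ.<? lr a) ∧ does (inj₂ (a , b) ∈R? atoms (R Π ι))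

  Xi⊆R : ∀ p → Xi p ≡ true → inj₂ p ∈ atoms (R Π ι)
  Xi⊆R (a , b) h = does-true (inj₂ (a , b) ∈R? atoms (R Π ι)) (∧-trueʳ {does (lr b ℕ.<? lr a)} h)

  Xi-true : ∀ {a b} → lr b ℕ.< lr a → inj₂ (a , b) ∈ atoms (R Π ι) → Xi (a , b) ≡ true
  Xi-true {a} {b} b<a m = ∧-true (dec-true (lr b ℕ.<? lr a) b<a) (dec-true (inj₂ (a , b) ∈R? atoms (R Π ι)) m)

  Y : Ext n → Bool
  Y = X ∪Ext Xi

  -- IComp holds: the rules of Π hold in X, and each regular a ∈ X has a rule with true body
  rules-true : eval Y (⋀ (map ruleF Π)) ≡ true
  rules-true = eval-⋀-map⁺ Y ruleF Π λ {r} rm →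
    trans (eval-rule X Xi r) (ruleSat-intro r λ pos-ok neg-ok → fires-in-X rm neg-ok pos-ok)

  derivation-body : ∀ {a k} (d : Derivation a k) → eval Y (bodyF (Derivation.deriving d)) ≡ true
  derivation-body d = trans (eval-body X Xi (Derivation.deriving d)) (Derivation.body-holds d)

  completions-true : eval Y (⋀ (map completion regular)) ≡ true
  completions-true = eval-⋀-map⁺ Y completion regular λ am → completion-true (∈-regular⁻ am)
    where
    completion-true : ∀ {a} → ι a ≡ false → eval Y (completion a) ≡ true
    completion-true {a} reg with X a in xa
    ... | false = refl
    ... | true  = eval-⋁-map⁺ Y bodyF (Derivation.deriving∈ d) (derivation-body d)
      where d = support a reg xa

  -- The supporting rule of a regular a ∈ X witnesses its level condition: with
  -- external positive body atoms it is ranked and their level atoms hold.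
  conditions-true : eval Y (R Π ι) ≡ true
  conditions-true = eval-⋀-map⁺ Y levelCondition regular λ am → condition-true (∈-regular⁻ am)
    where
    condition-true : ∀ {a} → ι a ≡ false → eval Y (levelCondition a) ≡ true
    condition-true {a} reg with X a in xa
    ... | false = refl
    ... | true  = by-external (posOut ι r) refl
      where
      d = support a reg xa
      open Derivation d
      r = deriving
      levels-true : eval Y (⋀ (map (λ b → var (inj₂ (a , b))) (posOut ι r))) ≡ true
      levels-true = eval-⋀-map⁺ Y (λ b → var (inj₂ (a , b))) (posOut ι r) λ bm →
        Xi-true (earlier (proj₁ (∈-filterᵇ⁻ {p = λ b → not (ι b)} {xs = pos r} bm))) (level∈R reg deriving∈ bm)
      by-external : ∀ bs → posOut ι r ≡ bs →
                    eval Y (⋁ (map (levelBody a) (rankedRules a))) ∨ eval Y (⋁ (map bodyF (unrankedRules a))) ≡ true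
      by-external []      none = ∨-trueʳ {eval Y (⋁ (map (levelBody a) (rankedRules a)))}
        (eval-⋁-map⁺ Y bodyF (∈-filterᵇ⁺ {p = λ r → null (posOut ι r)} deriving∈ (cong null none)) (derivation-body d))
      by-external (_ ∷ _) some = ∨-trueˡ
        (eval-⋁-map⁺ Y (levelBody a) (∈-filterᵇ⁺ {p = λ r → not (null (posOut ι r))} deriving∈ (cong (not ∘ null) some))
                     (∧-true (derivation-body d) levels-true))

  ν′ : V ⊎ Fin n → ℤ
  ν′ (inj₁ v) = ν v
  ν′ (inj₂ a) = + lr a

  atoms-of-Y : ∀ x → Y x ≡ true → x ∈ atoms Φ
  atoms-of-Y (inj₁ a) h with ι a in ia
  ... | true  = AtProg⇒formula (X⊆AtProg a h) ia
  ... | false = regular⇒formula ia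
  atoms-of-Y (inj₂ p) h = ∈-++⁺ʳ (atoms (IComp Π ι)) (Xi⊆R p h)

  ν′-solves : ∀ x (p : irrExt ι x ≡ true) → x ∈ atoms Φ →
              (Y x ≡ true → Sat ν′ (γ′ P x p)) × (Y x ≡ false → ¬ Sat ν′ (γ′ P x p))
  ν′-solves (inj₁ a) p m =
    let sat , unsat = proj₂ (proj₂ (proj₂ answer)) a p (formula-irregular m p)
        renamed = sat-rename ν′ (γ P a p)
    in (λ xa → subst id (sym renamed) (sat xa)) , (λ xa s → unsat xa (subst id renamed s))
  ν′-solves (inj₂ (a , b)) _ m =
    (λ xi → γR-complete ν′ a b (+<+ (does-true (lr b ℕ.<? lr a) (∧-trueˡ xi)))) ,
    (λ xi s → true≢false (trans (sym (Xi-true (ℤP.drop‿+<+ (γR-sound ν′ a b s)) (formula-level m))) xi))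

  model : ∃ λ (Xi : Fin n × Fin n → Bool) →
            (∀ p → Xi p ≡ true → inj₂ p ∈ atoms (R Π ι)) × IsModel (theFormula P) (X ∪Ext Xi)
  model = Xi , Xi⊆R , atoms-of-Y , ∧-true (∧-true rules-true completions-true) conditions-true , ν′ , ν′-solves

theorem10 : ∀ {n : ℕ} {V : Set} (P : CASProgram n V) (X : AtomSet n) →
    IsAnswerSet P X ⇔
    ∃ λ (Xi : Fin n × Fin n → Bool) →
      (∀ p → Xi p ≡ true → inj₂ p ∈ atoms (R (prog P) (irr P))) ×
      IsModel (theFormula P) (X ∪Ext Xi)
theorem10 P X = mk⇔ (AnswerSetToModel.model P X)
                    (λ { (Xi , _ , model) → ModelToAnswerSet.answer-set P X Xi model })
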